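{- Let $(G,w)$ be a weighted trigraph, let $(A,B,C)$ be a cut-partition of $G$, and let $S\subseteq V(G)$. Then $\mathrm{wt}_{(G[A\cup C],w)}(S\cap(A\cup C))+\mathrm{wt}_{(G[B\cup C],w)}(S\cap(B\cup C))=\mathrm{wt}_{(G,w)}(S)+\mathrm{wt}_{(G[C],w)}(S\cap C)$.
   Context: A trigraph $G$ consists of a finite set $V(G)$ and a function $\theta_G:\binom{V(G)}{2}\to\{ -1,0,1\}$; for distinct vertices $u,v$ write $uv$ for $\{u,v\}$; it is semi-adjacent if $\theta_G(uv)=0$ and strongly anti-adjacent if $\theta_G(uv)=-1$. For $X\subseteq V(G)$, $G[X]$ is the trigraph on $X$ with $\theta_G$ restricted to $\binom{X}{2}$. Let $D(G)=V(G)\cup\{(u,v): u,v\in V(G),u\neq v\}\cup\binom{V(G)}{2}$. A weight function for $G$ is a map $w:D(G)\to\mathbb{N}$ such that for all distinct $u,v$: if $uv$ is not semi-adjacent then $w(u,v)=w(v,u)=w(uv)=0$, and $w(u,v)\le w(uv)$. A weighted trigraph is a pair $(G,w)$; for $X\subseteq V(G)$, $(G[X],w)$ denotes $G[X]$ with $w$ restricted to $D(G[X])$. For $S\subseteq V(G)$, $\mathrm{wt}_{(G,w)}(S)=\sum_{u\in S}w(u)+\sum_{u\in S}\sum_{v\in V(G)\setminus S}w(u,v)+\sum_{uv\in\binom{V(G)\setminus S}{2}}w(uv)$. A cut-partition of $G$ is a partition $(A,B,C)$ of $V(G)$ with $A,B$ non-empty ($C$ possibly empty) such that every vertex of $A$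 is strongly anti-adjacent to every vertex of $B$. -}

module Defs where

open import Data.Nat using (ℕ; zero; suc; _+_; _≤_; _<_)
open import Data.Fin using (Fin; toℕ)
import Data.Fin as Fin
open import Data.Bool using (Bool; true; false; _∧_; _∨_; not; if_then_else_)
open import Data.Product using (_×_; Σ; ∃)
open import Data.Sum using (_⊎_)
open import Relation.Binary.PropositionalEquality using (_≡_; _≢_)
open import Relation.Nullary using (¬_)

-- values of θ : -1 (strongly anti-adjacent), 0 (semi-adjacent), 1
data Θ : Set where
  minus1 zero0 plus1 : Θ

-- A trigraph on vertex set Fin n: θ given on ordered pairs, required symmetric,
-- so it is a function on unordered pairs {u,v}, u ≠ v (diagonal values unused).
record Trigraph (n : ℕ) : Set where
  field
    θ    : Fin n → Fin n → Θ
    θ-sym : ∀ u v → θ u v ≡ θ v u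
open Trigraph public

SemiAdj : ∀ {n} → Trigraph n → Fin n → Fin n → Set
SemiAdj G u v = θ G u v ≡ zero0

-- Weight function w : D(G) → ℕ.
--   wV u      = w(u)
--   wO u v    = w(u,v)   (ordered pair)
--   wU u v    = w(uv)    (unordered pair; symmetric)
record Weight {n : ℕ} (G : Trigraph n) : Set where
  field
    wV : Fin n → ℕ
    wO : Fin n → Fin n → ℕ
    wU : Fin n → Fin n → ℕ
    wU-sym    : ∀ u v → wU u v ≡ wU v u
    nonsemi-O : ∀ u v → u ≢ v → ¬ SemiAdj G u v → wO u v ≡ 0
    nonsemi-U : ∀ u v → u ≢ v → ¬ SemiAdj G u v → wU u v ≡ 0
    O≤U       : ∀ u v → u ≢ v → wO u v ≤ wU u v
open Weight public

Subset : ℕ → Set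
Subset n = Fin n → Bool

_∩_ : ∀ {n} → Subset n → Subset n → Subset n
(X ∩ Y) u = X u ∧ Y u

_∪_ : ∀ {n} → Subset n → Subset n → Subset n
(X ∪ Y) u = X u ∨ Y u

Σ[] : ∀ n → (Fin n → ℕ) → ℕ
Σ[] zero    f = 0
Σ[] (suc n) f = f Fin.zero + Σ[] n (λ i → f (Fin.suc i))

ΣIn : ∀ {n} → Subset n → (Fin n → ℕ) → ℕ
ΣIn {n} X f = Σ[] n (λ u → if X u then f u else 0)

-- sum over unordered pairs {u,v} ⊆ X, u ≠ v (each counted once, via toℕ u < toℕ v)
open import Data.Nat using (_<ᵇ_)
ΣPairsIn : ∀ {n} → Subset n → (Fin n → Fin n → ℕ) → ℕ
ΣPairsIn X f = ΣIn X (λ u → ΣIn X (λ v → if toℕ u <ᵇ toℕ v then f u v else 0))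

-- wt_{(G[X],w)}(S) for S ⊆ X: the weight computed in the induced weighted
-- subtrigraph on vertex set X (w restricted to D(G[X])).
wtIn : ∀ {n} {G : Trigraph n} → Weight G → Subset n → Subset n → ℕ
wtIn w X S =
    ΣIn (X ∩ S) (wV w)
  + ΣIn (X ∩ S) (λ u → ΣIn (λ v → X v ∧ not (S v)) (λ v → wO w u v))
  + ΣPairsIn (λ v → X v ∧ not (S v)) (wU w)

Full : ∀ {n} → Subset n
Full _ = true

wt : ∀ {n} {G : Trigraph n} → Weight G → Subset n → ℕ
wt w S = wtIn w Full S

record CutPartition {n : ℕ} (G : Trigraph n) (A B C : Subset n) : Set where
  field
    partition : ∀ u → (A u ≡ true × B u ≡ false × C u ≡ false)
                    ⊎ (A u ≡ false × B u ≡ true × C u ≡ false)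
                    ⊎ (A u ≡ false × B u ≡ false × C u ≡ true)
    A-nonempty : ∃ λ u → A u ≡ true
    B-nonempty : ∃ λ u → B u ≡ true
    A-B-anti   : ∀ u v → A u ≡ true → B v ≡ true → θ G u v ≡ minus1

module Submission where

-- Every summand of
-- wt_(G[X],w)(S) has the form  [u ∈ X]·f(u)  or  [u ∈ X][v ∈ X]·g(u,v),
-- where f and g depend on S and w but not on X (normal form, after first
-- noting that the weight in G[X] only sees S ∩ X).  For a partition
-- (A,B,C) the indicators satisfy, vertex by vertex and pair by pair,
--     [u ∈ A∪C] + [u ∈ B∪C] = 1 + [u ∈ C]        and
--     [u,v ∈ A∪C] + [u,v ∈ B∪C] = 1 + [u,v ∈ C]
-- unless one of u, v lies in A and the other in B.  Such pairs are strongly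
-- anti-adjacent in a cut-partition, and every weight vanishes on them.
-- Summing these pointwise identities shows that X ↦ wt_(G[X],w)(S) is
-- modular on the triple A∪C, B∪C, C, which is the proposition.

open import Defs
open import Data.Nat using (ℕ; zero; suc; _+_; _<ᵇ_)
open import Data.Nat.Properties using (+-comm; +-commutativeSemigroup)
open import Algebra.Properties.CommutativeSemigroup +-commutativeSemigroup
  using (interchange)
open import Data.Bool using (Bool; true; false; _∧_; _∨_; not; if_then_else_)
open import Data.Bool.Properties using (∧-identityʳ)
open import Data.Product using (_×_; _,_; proj₁; proj₂)
open import Data.Sum using (_⊎_; inj₁; inj₂)
open import Data.Empty using (⊥)
open import Data.Fin using (Fin; toℕ)
import Data.Fin as Fin
open import Relation.Nullary using (¬_)
open import Relation.Binary.PropositionalEquality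
  using (_≡_; _≢_; refl; sym; trans; cong; cong₂; module ≡-Reasoning)

-- The indicator product: b ⊙ x is x when b holds and 0 otherwise.  It is
-- stated with the same conditional as the sums of Defs, so they unfold to it.
infixr 7 _⊙_
_⊙_ : Bool → ℕ → ℕ
b ⊙ x = if b then x else 0

⊙-zero : ∀ b {x} → x ≡ 0 → b ⊙ x ≡ 0
⊙-zero true  x≡0 = x≡0
⊙-zero false _   = refl

⊙-∧ : ∀ a b x → (a ∧ b) ⊙ x ≡ a ⊙ b ⊙ x
⊙-∧ true  b x = refl
⊙-∧ false b x = refl

⊙-interchange : ∀ a b c d x → (a ∧ b) ⊙ (c ∧ d) ⊙ x ≡ a ⊙ c ⊙ b ⊙ d ⊙ x
⊙-interchange false b     c     d x = refl
⊙-interchange true  false false d x = refl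
⊙-interchange true  false true  d x = refl
⊙-interchange true  true  false d x = refl
⊙-interchange true  true  true  d x = refl

Σ-zero : ∀ n → Σ[] n (λ _ → 0) ≡ 0
Σ-zero zero    = refl
Σ-zero (suc n) = Σ-zero n

Σ-cong : ∀ n {f g : Fin n → ℕ} → (∀ u → f u ≡ g u) → Σ[] n f ≡ Σ[] n g
Σ-cong zero    f≗g = refl
Σ-cong (suc n) f≗g = cong₂ _+_ (f≗g Fin.zero) (Σ-cong n (λ i → f≗g (Fin.suc i)))

Σ-+ : ∀ n (f g : Fin n → ℕ) → Σ[] n f + Σ[] n g ≡ Σ[] n (λ u → f u + g u)
Σ-+ zero    f g = refl
Σ-+ (suc n) f g =
  trans (interchange (f Fin.zero) (Σ[] n (λ i → f (Fin.suc i)))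
                     (g Fin.zero) (Σ[] n (λ i → g (Fin.suc i))))
        (cong (f Fin.zero + g Fin.zero +_) (Σ-+ n _ _))

Σ-pointwise : ∀ n {f g f′ g′ : Fin n → ℕ} →
  (∀ u → f u + g u ≡ f′ u + g′ u) →
  Σ[] n f + Σ[] n g ≡ Σ[] n f′ + Σ[] n g′
Σ-pointwise n {f} {g} {f′} {g′} e =
  trans (Σ-+ n f g) (trans (Σ-cong n e) (sym (Σ-+ n f′ g′)))

⊙-Σ : ∀ n b (f : Fin n → ℕ) → b ⊙ Σ[] n f ≡ Σ[] n (λ u → b ⊙ f u)
⊙-Σ n true  f = refl
⊙-Σ n false f = sym (Σ-zero n)

ΣIn-cong : ∀ {n} {X Y : Subset n} {f g : Fin n → ℕ} →
  (∀ u → X u ≡ Y u) → (∀ u → f u ≡ g u) → ΣIn X f ≡ ΣIn Y g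
ΣIn-cong {n} X≗Y f≗g = Σ-cong n (λ u → cong₂ _⊙_ (X≗Y u) (f≗g u))

onPairs : ∀ {n} → Subset n → (Fin n → Fin n → ℕ) → ℕ
onPairs {n} X g = Σ[] n (λ u → Σ[] n (λ v → X u ⊙ X v ⊙ g u v))

∁ : ∀ {n} → Subset n → Subset n
∁ S u = not (S u)

ΣIn²-onPairs : ∀ {n} (X Q T : Subset n) (h : Fin n → Fin n → ℕ) →
  ΣIn (X ∩ Q) (λ u → ΣIn (X ∩ T) (h u))
    ≡ onPairs X (λ u v → Q u ⊙ T v ⊙ h u v)
ΣIn²-onPairs {n} X Q T h = Σ-cong n λ u →
  trans (⊙-Σ n (X u ∧ Q u) _)
        (Σ-cong n (λ v → ⊙-interchange (X u) (Q u) (X v) (T v) (h u v)))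

module _ {n} {G : Trigraph n} (w : Weight G) where

  wtIn-restrict : ∀ X S → wtIn w X (S ∩ X) ≡ wtIn w X S
  wtIn-restrict X S =
    cong₂ _+_ (cong₂ _+_ (ΣIn-cong inside λ _ → refl)
                         (ΣIn-cong inside λ _ → ΣIn-cong outside λ _ → refl))
              (ΣIn-cong outside λ _ → ΣIn-cong outside λ _ → refl)
    where
    inside : ∀ u → X u ∧ (S u ∧ X u) ≡ X u ∧ S u
    inside u with X u
    ... | true  = ∧-identityʳ (S u)
    ... | false = refl
    outside : ∀ u → X u ∧ not (S u ∧ X u) ≡ X u ∧ not (S u)
    outside u with X u
    ... | true  = cong not (∧-identityʳ (S u))
    ... | false = refl

  vertexPart : Subset n → Fin n → ℕ
  vertexPart S u = S u ⊙ wV w u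

  leavingPart : Subset n → Fin n → Fin n → ℕ
  leavingPart S u v = S u ⊙ not (S v) ⊙ wO w u v

  outsidePart : Subset n → Fin n → Fin n → ℕ
  outsidePart S u v = not (S u) ⊙ not (S v) ⊙ (toℕ u <ᵇ toℕ v) ⊙ wU w u v

  normalForm : Subset n → Subset n → ℕ
  normalForm X S = ΣIn X (vertexPart S)
                 + onPairs X (leavingPart S) + onPairs X (outsidePart S)

  wtIn-normal : ∀ X S → wtIn w X S ≡ normalForm X S
  wtIn-normal X S =
    cong₂ _+_ (cong₂ _+_ (Σ-cong n (λ u → ⊙-∧ (X u) (S u) (wV w u)))
                         (ΣIn²-onPairs X S (∁ S) (wO w)))
              (ΣIn²-onPairs X (∁ S) (∁ S) (λ u v → (toℕ u <ᵇ toℕ v) ⊙ wU w u v))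

-- A pair function vanishing on all strongly anti-adjacent pairs: weights
-- are of this kind, since they vanish on all non-semi-adjacent pairs.
module _ {n} (G : Trigraph n) where

  AntiVanishing : (Fin n → Fin n → ℕ) → Set
  AntiVanishing g = ∀ u v → u ≢ v → θ G u v ≡ minus1 → g u v ≡ 0

  anti⇒¬semi : ∀ {u v} → θ G u v ≡ minus1 → ¬ SemiAdj G u v
  anti⇒¬semi anti semi with trans (sym anti) semi
  ... | ()

module _ {n} {G : Trigraph n} (w : Weight G) where

  leavingPart-vanishing : ∀ S → AntiVanishing G (leavingPart w S)
  leavingPart-vanishing S u v u≢v anti =
    ⊙-zero (S u) (⊙-zero (not (S v)) (nonsemi-O w u v u≢v (anti⇒¬semi G anti)))

  outsidePart-vanishing : ∀ S → AntiVanishing G (outsidePart w S)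
  outsidePart-vanishing S u v u≢v anti =
    ⊙-zero (not (S u)) (⊙-zero (not (S v)) (⊙-zero (toℕ u <ᵇ toℕ v)
      (nonsemi-U w u v u≢v (anti⇒¬semi G anti))))

ExactlyOne : Bool → Bool → Bool → Set
ExactlyOne a b c = (a ≡ true × b ≡ false × c ≡ false)
                 ⊎ (a ≡ false × b ≡ true × c ≡ false)
                 ⊎ (a ≡ false × b ≡ false × c ≡ true)

notBoth : ∀ {a b c} → ExactlyOne a b c → a ≡ true → b ≡ true → ⊥
notBoth (inj₁ (_ , refl , _))        _  ()
notBoth (inj₂ (inj₁ (refl , _ , _))) () _
notBoth (inj₂ (inj₂ (refl , _ , _))) () _

vertex-modular : ∀ {a b c} x → ExactlyOne a b c →
  (a ∨ c) ⊙ x + (b ∨ c) ⊙ x ≡ x + c ⊙ x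
vertex-modular x (inj₁ (refl , refl , refl))        = refl
vertex-modular x (inj₂ (inj₁ (refl , refl , refl))) = +-comm 0 x
vertex-modular x (inj₂ (inj₂ (refl , refl , refl))) = refl

pair-modular : ∀ {a b c a′ b′ c′} x → ExactlyOne a b c → ExactlyOne a′ b′ c′ →
  (a ≡ true → b′ ≡ true → x ≡ 0) → (b ≡ true → a′ ≡ true → x ≡ 0) →
  (a ∨ c) ⊙ (a′ ∨ c′) ⊙ x + (b ∨ c) ⊙ (b′ ∨ c′) ⊙ x ≡ x + c ⊙ c′ ⊙ x
pair-modular x (inj₁ (refl , refl , refl)) (inj₁ (refl , refl , refl)) _ _ = refl
pair-modular x (inj₁ (refl , refl , refl)) (inj₂ (inj₁ (refl , refl , refl))) ab _
  rewrite ab refl refl = refl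
pair-modular x (inj₁ (refl , refl , refl)) (inj₂ (inj₂ (refl , refl , refl))) _ _ = refl
pair-modular x (inj₂ (inj₁ (refl , refl , refl))) (inj₁ (refl , refl , refl)) _ ba
  rewrite ba refl refl = refl
pair-modular x (inj₂ (inj₁ (refl , refl , refl))) (inj₂ (inj₁ (refl , refl , refl))) _ _ =
  +-comm 0 x
pair-modular x (inj₂ (inj₁ (refl , refl , refl))) (inj₂ (inj₂ (refl , refl , refl))) _ _ =
  +-comm 0 x
pair-modular x (inj₂ (inj₂ (refl , refl , refl))) (inj₁ (refl , refl , refl)) _ _ = refl
pair-modular x (inj₂ (inj₂ (refl , refl , refl))) (inj₂ (inj₁ (refl , refl , refl))) _ _ =
  +-comm 0 x
pair-modular x (inj₂ (inj₂ (refl , refl , refl))) (inj₂ (inj₂ (refl , refl , refl))) _ _ = refl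

module _ {n} {G : Trigraph n} {A B C : Subset n} (cp : CutPartition G A B C) where
  open CutPartition cp

  Modular : (Subset n → ℕ) → Set
  Modular F = F (A ∪ C) + F (B ∪ C) ≡ F Full + F C

  Modular-+ : ∀ F H → Modular F → Modular H → Modular (λ X → F X + H X)
  Modular-+ F H mF mH =
    trans (interchange (F (A ∪ C)) (H (A ∪ C)) (F (B ∪ C)) (H (B ∪ C)))
          (trans (cong₂ _+_ mF mH) (sym (interchange (F Full) (H Full) (F C) (H C))))

  ΣIn-modular : ∀ f → Modular (λ X → ΣIn X f)
  ΣIn-modular f = Σ-pointwise n (λ u → vertex-modular (f u) (partition u))

  cut-distinct : ∀ {u v} → A u ≡ true → B v ≡ true → u ≢ v
  cut-distinct {u} Au Bv refl = notBoth (partition u) Au Bv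

  cut-vanishing : ∀ {g} → AntiVanishing G g →
    ∀ u v → A u ≡ true → B v ≡ true → g u v ≡ 0 × g v u ≡ 0
  cut-vanishing g-van u v Au Bv =
    g-van u v (cut-distinct Au Bv) (A-B-anti u v Au Bv) ,
    g-van v u (λ v≡u → cut-distinct Au Bv (sym v≡u))
              (trans (θ-sym G v u) (A-B-anti u v Au Bv))

  onPairs-modular : ∀ {g} → AntiVanishing G g → Modular (λ X → onPairs X g)
  onPairs-modular {g} g-van = Σ-pointwise n λ u → Σ-pointwise n λ v →
    pair-modular (g u v) (partition u) (partition v)
      (λ Au Bv → proj₁ (cut-vanishing g-van u v Au Bv))
      (λ Bu Av → proj₂ (cut-vanishing g-van v u Av Bu))

  normalForm-modular : (w : Weight G) (S : Subset n) → Modular (λ X → normalForm w X S)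
  normalForm-modular w S =
    Modular-+ (λ X → ΣIn X (vertexPart w S) + onPairs X (leavingPart w S))
              (λ X → onPairs X (outsidePart w S))
      (Modular-+ (λ X → ΣIn X (vertexPart w S)) (λ X → onPairs X (leavingPart w S))
        (ΣIn-modular (vertexPart w S))
        (onPairs-modular (leavingPart-vanishing w S)))
      (onPairs-modular (outsidePart-vanishing w S))

proposition3p3 : ∀ {n} (G : Trigraph n) (w : Weight G) (A B C S : Subset n) →
    CutPartition G A B C →
    wtIn w (A ∪ C) (S ∩ (A ∪ C)) + wtIn w (B ∪ C) (S ∩ (B ∪ C))
      ≡ wt w S + wtIn w C (S ∩ C)
proposition3p3 G w A B C S cp = begin
    wtIn w (A ∪ C) (S ∩ (A ∪ C)) + wtIn w (B ∪ C) (S ∩ (B ∪ C))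
  ≡⟨ cong₂ _+_ (restrict (A ∪ C)) (restrict (B ∪ C)) ⟩
    wtIn w (A ∪ C) S + wtIn w (B ∪ C) S
  ≡⟨ cong₂ _+_ (normal (A ∪ C)) (normal (B ∪ C)) ⟩
    normalForm w (A ∪ C) S + normalForm w (B ∪ C) S
  ≡⟨ normalForm-modular cp w S ⟩
    normalForm w Full S + normalForm w C S
  ≡⟨ sym (cong₂ _+_ (normal Full) (trans (restrict C) (normal C))) ⟩
    wt w S + wtIn w C (S ∩ C)
  ∎
  where
  open ≡-Reasoning
  restrict : ∀ X → wtIn w X (S ∩ X) ≡ wtIn w X S
  restrict X = wtIn-restrict w X S
  normal : ∀ X → wtIn w X S ≡ normalForm w X S
  normal X = wtIn-normal w X S
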